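{- For all positive integers $m_1,m_2$, there exists an integral sequence $(f_j)_{j\geq 0}$ such that for all $j\in\mathbb{Z}_{\geq 0}$: (i) $0\leq f_j\leq m_1+m_2$; (ii) $f_j+j$ is divisible by $m_1$; and (iii) $((f_j-j)\bmod m_2)\in\{0,1,\dots,m_1\}$.
   Context: For integers $a$ and $b>0$, $(a\bmod b)\in\{0,\dots,b-1\}$ denotes the remainder of $a$ upon division by $b$. -}

module Defs where

{-# OPTIONS --safe #-}
-- Take f j = (j mod m₂) + d j, where d j ∈ [0, m₁) is the least correction making f j + j
-- divisible by m₁. Then f j - j = d j - m₂ ⌊j / m₂⌋ ≡ d j (mod m₂), and d j mod m₂ ≤ d j < m₁.
module Submission where

open import Defs
open import Data.Nat using (ℕ; NonZero)
open import Data.Integer using (ℤ; +_; _+_; _-_; _≤_; _%ℕ_; _*_; -_; ∣_∣; +≤+; _/ℕ_; _⊖_)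
open import Data.Integer.Divisibility using (_∣_)
open import Data.Product using (∃; _×_; _,_)
import Data.Nat as ℕ
open import Data.Integer.DivMod using (a≡a%ℕn+[a/ℕn]*n; n%ℕd<d)
import Data.Integer.Divisibility.Signed as Signed
import Data.Integer.Properties as ℤ
import Data.Nat.Properties as ℕ
import Data.Nat.DivMod as ℕ
import Data.Nat.Divisibility as ℕ
open import Data.Integer.Tactic.RingSolver using (solve-∀)
import Data.Nat.Tactic.RingSolver as ℕSolver
open import Relation.Binary.PropositionalEquality
open import Relation.Nullary using (contradiction)

∣+m-+n∣<k : ∀ {m n k} → m ℕ.< k → n ℕ.< k → ∣ + m - + n ∣ ℕ.< k
∣+m-+n∣<k {m} {n} m<k n<k = begin-strict
  ∣ + m - + n ∣ ≡⟨ cong ∣_∣ (ℤ.m-n≡m⊖n m n) ⟩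
  ∣ m ⊖ n ∣     ≤⟨ ℤ.∣m⊝n∣≤m⊔n m n ⟩
  m ℕ.⊔ n       <⟨ ℕ.⊔-lub m<k n<k ⟩
  _             ∎
  where open ℕ.≤-Reasoning

∣i∣<n∧n∣i⇒i≡0 : ∀ {i n} → ∣ i ∣ ℕ.< n → + n ∣ i → i ≡ + 0
∣i∣<n∧n∣i⇒i≡0 {i} ∣i∣<n n∣i with ∣ i ∣ in ∣i∣≡
... | ℕ.zero  = ℤ.∣i∣≡0⇒i≡0 ∣i∣≡
... | ℕ.suc _ = contradiction n∣i (ℕ.>⇒∤ ∣i∣<n)

a+bk≡c+dk⇒a-c≡[d-b]k : ∀ a b c d k → a + b * k ≡ c + d * k → a - c ≡ (d - b) * k
a+bk≡c+dk⇒a-c≡[d-b]k a b c d k eq = begin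
  a - c                                   ≡⟨ regroup a b c d k ⟩
  (a + b * k) - (c + d * k) + (d - b) * k ≡⟨ cong (λ x → x - (c + d * k) + (d - b) * k) eq ⟩
  (c + d * k) - (c + d * k) + (d - b) * k ≡⟨ cancel (c + d * k) ((d - b) * k) ⟩
  (d - b) * k                             ∎
  where
  open ≡-Reasoning
  regroup : ∀ a b c d k → a - c ≡ (a + b * k) - (c + d * k) + (d - b) * k
  regroup = solve-∀
  cancel : ∀ x y → x - x + y ≡ y
  cancel = solve-∀

%ℕ-unique : ∀ i q r n .{{_ : NonZero n}} → r ℕ.< n → i ≡ + r + q * + n → i %ℕ n ≡ r
%ℕ-unique i q r n r<n i≡r+qn = ℤ.+-injective (ℤ.i-j≡0⇒i≡j (+ (i %ℕ n)) (+ r) difference≡0)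
  where
  difference≡multiple : + (i %ℕ n) - + r ≡ (q - i /ℕ n) * + n
  difference≡multiple = a+bk≡c+dk⇒a-c≡[d-b]k (+ (i %ℕ n)) (i /ℕ n) (+ r) q (+ n)
    (trans (sym (a≡a%ℕn+[a/ℕn]*n i n)) i≡r+qn)
  difference≡0 : + (i %ℕ n) - + r ≡ + 0
  difference≡0 = ∣i∣<n∧n∣i⇒i≡0 (∣+m-+n∣<k (n%ℕd<d i n) r<n)
    (Signed.∣⇒∣ᵤ (Signed.divides (q - i /ℕ n) difference≡multiple))

[i+k*n]%ℕn≡i%ℕn : ∀ i k n .{{_ : NonZero n}} → (i + k * + n) %ℕ n ≡ i %ℕ n
[i+k*n]%ℕn≡i%ℕn i k n = %ℕ-unique (i + k * + n) (i /ℕ n + k) (i %ℕ n) n (n%ℕd<d i n) (begin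
  i + k * + n                                   ≡⟨ cong (_+ k * + n) (a≡a%ℕn+[a/ℕn]*n i n) ⟩
  + (i %ℕ n) + i /ℕ n * + n + k * + n           ≡⟨ regroup (+ (i %ℕ n)) (i /ℕ n) k (+ n) ⟩
  + (i %ℕ n) + (i /ℕ n + k) * + n               ∎)
  where
  open ≡-Reasoning
  regroup : ∀ r q k n → r + q * n + k * n ≡ r + (q + k) * n
  regroup = solve-∀

n∣[-i]%ℕn+i : ∀ i n .{{_ : NonZero n}} → + n ∣ + ((- i) %ℕ n) + i
n∣[-i]%ℕn+i i n = Signed.∣⇒∣ᵤ (Signed.divides (- (- i /ℕ n)) (begin
  + r + i                   ≡⟨ regroup (+ r) (- i /ℕ n) i (+ n) ⟩
  (+ r + q * + n) + i - q * + n ≡⟨ cong (λ x → x + i - q * + n) (a≡a%ℕn+[a/ℕn]*n (- i) n) ⟨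
  - i + i - q * + n         ≡⟨ cancel i q (+ n) ⟩
  (- q) * + n               ∎))
  where
  open ≡-Reasoning
  r = (- i) %ℕ n
  q = (- i) /ℕ n
  regroup : ∀ r q i n → r + i ≡ (r + q * n) + i - q * n
  regroup = solve-∀
  cancel : ∀ i q n → - i + i - q * n ≡ (- q) * n
  cancel = solve-∀

+[m+n]-+[m+k*l]≡+n+[-k]*l : ∀ m n k l → + (m ℕ.+ n) - + (m ℕ.+ k ℕ.* l) ≡ + n + (- + k) * + l
+[m+n]-+[m+k*l]≡+n+[-k]*l m n k l = begin
  + m + + n - (+ m + + (k ℕ.* l)) ≡⟨ cong (λ x → + m + + n - (+ m + x)) (ℤ.pos-* k l) ⟩
  + m + + n - (+ m + + k * + l)   ≡⟨ cancel (+ m) (+ n) (+ k) (+ l) ⟩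
  + n + (- + k) * + l             ∎
  where
  open ≡-Reasoning
  cancel : ∀ m n k l → m + n - (m + k * l) ≡ n + (- k) * l
  cancel = solve-∀

module Witness (m₁ m₂ : ℕ) .{{_ : NonZero m₁}} .{{_ : NonZero m₂}} where

  correction : ℕ → ℕ
  correction j = (- + (j ℕ.+ j ℕ.% m₂)) %ℕ m₁

  f : ℕ → ℕ
  f j = j ℕ.% m₂ ℕ.+ correction j

  correction<m₁ : ∀ j → correction j ℕ.< m₁
  correction<m₁ j = n%ℕd<d (- + (j ℕ.+ j ℕ.% m₂)) m₁

  f≤m₁+m₂ : ∀ j → f j ℕ.≤ m₁ ℕ.+ m₂
  f≤m₁+m₂ j = begin
    j ℕ.% m₂ ℕ.+ correction j ≤⟨ ℕ.+-mono-≤ (ℕ.<⇒≤ (ℕ.m%n<n j m₂)) (ℕ.<⇒≤ (correction<m₁ j)) ⟩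
    m₂ ℕ.+ m₁                 ≡⟨ ℕ.+-comm m₂ m₁ ⟩
    m₁ ℕ.+ m₂                 ∎
    where open ℕ.≤-Reasoning

  m₁∣f+j : ∀ j → + m₁ ∣ + f j + + j
  m₁∣f+j j = subst (+ m₁ ∣_) (cong +_ (regroup (j ℕ.% m₂) (correction j) j))
    (n∣[-i]%ℕn+i (+ (j ℕ.+ j ℕ.% m₂)) m₁)
    where
    regroup : ∀ x d j → d ℕ.+ (j ℕ.+ x) ≡ x ℕ.+ d ℕ.+ j
    regroup = ℕSolver.solve-∀

  [f-j]%m₂≤m₁ : ∀ j → (+ f j - + j) %ℕ m₂ ℕ.≤ m₁
  [f-j]%m₂≤m₁ j = begin
    (+ f j - + j) %ℕ m₂                      ≡⟨ cong (λ i → (+ f j - + i) %ℕ m₂) (ℕ.m≡m%n+[m/n]*n j m₂) ⟩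
    (+ f j - + (j ℕ.% m₂ ℕ.+ q ℕ.* m₂)) %ℕ m₂  ≡⟨ cong (_%ℕ m₂) (+[m+n]-+[m+k*l]≡+n+[-k]*l (j ℕ.% m₂) (correction j) q m₂) ⟩
    (+ correction j + (- + q) * + m₂) %ℕ m₂  ≡⟨ [i+k*n]%ℕn≡i%ℕn (+ correction j) (- + q) m₂ ⟩
    correction j ℕ.% m₂                      ≤⟨ ℕ.m%n≤m (correction j) m₂ ⟩
    correction j                             <⟨ correction<m₁ j ⟩
    m₁                                       ∎
    where
    open ℕ.≤-Reasoning
    q = j ℕ./ m₂

lemmaA3 : (m₁ m₂ : ℕ) → .{{_ : NonZero m₁}} → .{{_ : NonZero m₂}} →
    ∃ λ (f : ℕ → ℤ) → (j : ℕ) →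
    ((+ 0 ≤ f j) × (f j ≤ + (m₁ ℕ.+ m₂)))
    × (+ m₁ ∣ (f j + + j))
    × (((f j - + j) %ℕ m₂) ℕ.≤ m₁)
lemmaA3 m₁ m₂ = (λ j → + f j) , λ j →
  (+≤+ ℕ.z≤n , +≤+ (f≤m₁+m₂ j)) , m₁∣f+j j , [f-j]%m₂≤m₁ j
  where open Witness m₁ m₂
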